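{- Let $\mu\le\lambda$ be integer partitions and consider the interval $[\mu,\lambda]$ in Young's lattice. Let $n$ be the smallest integer such that $\mu\le\delta_n$. If $\delta_{n+1}\le\lambda$, then the lattice $[\mu,\lambda]$ is an Eeta win if and only if $\mathrm{path}(\lambda)$ does not contain an odd-length block of east steps immediately followed by an odd-length block of north steps.
   Context: Young's lattice is the lattice of integer partitions ordered by containment of Young diagrams. The staircase is $\delta_n=(n,n-1,\dots,1)$ for $n\ge 0$ ($\delta_0=\emptyset$). A lattice path is a finite word in $\mathrm{N}$ (unit north step) and $\mathrm{E}$ (unit east step); a block is a maximal consecutive string of equal steps. For $\lambda=(\lambda_1,\dots,\lambda_k)$ with $\lambda_1\ge\cdots\ge\lambda_k\ge1$, $\mathrm{path}(\lambda)=\mathrm{E}^{\lambda_k}\mathrm{N}\mathrm{E}^{\lambda_{k-1}-\lambda_k}\mathrm{N}\cdots\mathrm{E}^{\lambda_1-\lambda_2}\mathrm{N}$ (the southeast boundary of $\lambda$). Ungar game: for a finite lattice $L$ and $x\in L$, an Ungar move sends $x$ to $\bigwedge(\{x\}\cup T)$ with $T$ a subset of the elements covered by $x$; it is nontrivial if $T\ne\emptyset$. Starting at the top element $\hat1$, Atniss (first) and Eeta alternately make nontrivial Ungar moves; the player who cannot move (i.e. faces $\hat0$) loses. $L$ is an Atniss win if Atniss has a winning strategy, otherwise an Eeta win. -}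

module Defs where

open import Data.Nat using (ℕ; zero; suc; _+_; _*_; _∸_; _≤_; _<_; _≥_)
open import Data.List using (List; []; _∷_; _++_; replicate; reverse; [_])
open import Data.List.Relation.Unary.All using (All)
open import Data.List.Relation.Unary.Linked using (Linked)
open import Data.Product using (Σ; ∃; _×_; _,_; proj₁)
open import Data.Empty using (⊥)
open import Relation.Nullary using (¬_)
open import Relation.Binary.PropositionalEquality using (_≡_; _≢_)

IsPartition : List ℕ → Set
IsPartition l = Linked _≥_ l × All (λ a → 1 ≤ a) l

-- i-th part (0-indexed), padded with zeros.
part : List ℕ → ℕ → ℕ
part []       _       = 0
part (a ∷ _)  zero    = a
part (_ ∷ as) (suc i) = part as i

_⊑_ : List ℕ → List ℕ → Set
μ ⊑ λ′ = ∀ i → part μ i ≤ part λ′ i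

δ : ℕ → List ℕ
δ zero    = []
δ (suc n) = suc n ∷ δ n

data Step : Set where
  N E : Step

pathAux : ℕ → List ℕ → List Step
pathAux prev []       = []
pathAux prev (a ∷ as) = replicate (a ∸ prev) E ++ (N ∷ pathAux a as)

-- path(λ) = E^{λ_k} N E^{λ_{k-1}-λ_k} N ... E^{λ_1-λ_2} N
path : List ℕ → List Step
path λ′ = pathAux 0 (reverse λ′)

Odd : ℕ → Set
Odd m = ∃ λ k → m ≡ suc (2 * k)

-- w contains a (maximal) block E^i immediately followed by a (maximal)
-- block N^j with i and j odd.
HasOddEOddN : List Step → Set
HasOddEOddN w =
  Σ (List Step) λ u → Σ ℕ λ i → Σ ℕ λ j → Σ (List Step) λ v →
    (w ≡ u ++ (replicate i E ++ (replicate j N ++ v))) ×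
    Odd i × Odd j ×
    (¬ (∃ λ u′ → u ≡ u′ ++ [ E ])) ×
    (¬ (∃ λ v′ → v ≡ N ∷ v′))

module Ungar (P : Set) (_≤P_ : P → P → Set) where

  _<P_ : P → P → Set
  z <P x = z ≤P x × ¬ (x ≤P z)

  Covers : P → P → Set
  Covers x z = z <P x × (∀ w → z <P w → w <P x → ⊥)

  IsMeet : List P → P → Set
  IsMeet S y = All (λ s → y ≤P s) S × (∀ z → All (λ s → z ≤P s) S → z ≤P y)

  Move : P → P → Set
  Move x y = Σ (List P) λ T → T ≢ [] × All (Covers x) T × IsMeet (x ∷ T) y

  data Win (x : P) : Set
  data Lose (x : P) : Set

  data Win x where
    win : ∀ y → Move x y → Lose y → Win x

  data Lose x where
    lose : (∀ y → Move x y → Win y) → Lose x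

  AtnissWin : P → Set
  AtnissWin top = Win top

  EetaWin : P → Set
  EetaWin top = ¬ AtnissWin top

Interval : List ℕ → List ℕ → Set
Interval μ λ′ = Σ (List ℕ) λ ν → IsPartition ν × μ ⊑ ν × ν ⊑ λ′

_≤I_ : ∀ {μ λ′} → Interval μ λ′ → Interval μ λ′ → Set
x ≤I y = proj₁ x ⊑ proj₁ y

module YoungUngar (μ λ′ : List ℕ) = Ungar (Interval μ λ′) (_≤I_ {μ} {λ′})

topI : (μ λ′ : List ℕ) → IsPartition λ′ → μ ⊑ λ′ → Interval μ λ′
topI μ λ′ pλ μ⊑λ = λ′ , pλ , μ⊑λ , (λ i → Data.Nat.Properties.≤-refl)
  where import Data.Nat.Properties

IntervalEetaWin : (μ λ′ : List ℕ) → IsPartition λ′ → μ ⊑ λ′ → Set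
IntervalEetaWin μ λ′ pλ μ⊑λ = YoungUngar.EetaWin μ λ′ (topI μ λ′ pλ μ⊑λ)

{-# OPTIONS --safe #-}

-- Let f and g be the row lengths of a partition ν ∈ [μ, λ] and of μ. A nontrivial Ungar move from ν
-- removes one cell from each row of a nonempty set of rows ending in a removable corner. At each row,
-- look at the east run of the boundary of ν/μ under the end of that row and at the north run that
-- follows it. The player to move from ν loses exactly when no row has both runs odd. From such a ν
-- every move creates an odd pair: otherwise, at the bottom row of a run of removed rows the east run
-- would be odd, hence the north run even, and following that north run upwards would give another
-- such row strictly higher up, which cannot go on forever. From any other ν one moves to such a position by removing the rows of
-- a fixed point of "remove row k iff keeping it would leave an odd pair at k", which can be built row
-- by row from the top. If μ ⊆ δ_n and δ_{n+1} ⊆ λ, then μ never touches the boundary of λ, so at λ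
-- these runs are exactly the blocks of path(λ).

module Submission where

open import Defs
open import Data.Bool using (Bool; true; false; not; _∧_; _∨_)
import Data.Bool as Bool
open import Data.Bool.Properties using (not-involutive; ∧-identityʳ; ∧-zeroʳ; ∨-zeroʳ; ¬-not)
open import Data.Empty using (⊥; ⊥-elim)
open import Data.List using (List; []; _∷_; _++_; [_]; replicate; reverse; length)
open import Data.List.Properties using (∷-injectiveʳ; ++-conicalʳ; ++-assoc; unfold-reverse)
open import Data.List.Relation.Unary.All using (All; []; _∷_)
open import Data.List.Relation.Unary.Linked using (Linked; []; [-]; _∷_)
open import Data.Nat.ListAction using (sum)
open import Data.Nat
open import Data.Nat.Induction using (<-rec; <-wellFounded)
open import Data.Nat.Properties
open import Data.Product
open import Data.Sum using (_⊎_; inj₁; inj₂)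
open import Function using (_∘_)
open import Induction.WellFounded using (module All)
import Relation.Binary.Construct.On as On
open import Relation.Binary.PropositionalEquality hiding ([_])
open import Relation.Nullary
open import Relation.Nullary.Decidable using (_×-dec_; dec-true; dec-false)

bit : Bool → ℕ
bit false = 0
bit true  = 1

odd? : ℕ → Bool
odd? zero    = false
odd? (suc n) = not (odd? n)

odd?-pred : ∀ {x} → 0 < x → odd? (x ∸ 1) ≡ not (odd? x)
odd?-pred {suc x} _ = sym (not-involutive (odd? x))

not≡true : ∀ {b} → not b ≡ true → b ≡ false
not≡true {false} _ = refl

not≡false : ∀ {b} → not b ≡ false → b ≡ true
not≡false {true} _ = refl

∧-true-left : ∀ {a b} → a ∧ b ≡ true → a ≡ true
∧-true-left {true} _ = refl

∧-true-right : ∀ {a b} → a ∧ b ≡ true → b ≡ true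
∧-true-right {true} e = e

true-or-false : ∀ b → b ≡ true ⊎ b ≡ false
true-or-false true  = inj₁ refl
true-or-false false = inj₂ refl

true≢false : true ≢ false
true≢false ()

does≡true⇒ : ∀ {P : Set} (P? : Dec P) → does P? ≡ true → P
does≡true⇒ (yes p) _ = p

n∸1<n : ∀ {n} → 0 < n → n ∸ 1 < n
n∸1<n {suc n} _ = n<1+n n

[m∸n]∸o≡[m∸o]∸n : ∀ m n o → m ∸ n ∸ o ≡ m ∸ o ∸ n
[m∸n]∸o≡[m∸o]∸n m n o = trans (∸-+-assoc m n o) (trans (cong (m ∸_) (+-comm n o)) (sym (∸-+-assoc m o n)))

∸-pred⊔ : ∀ x y z → 0 < y → y ≤ x → x ∸ (pred y ⊔ z) ≡ x ∸ (y ⊔ z) + bit (does (z <? y))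
∸-pred⊔ x (suc p) z _ y≤x with z <? suc p
... | yes z<y = begin
  x ∸ (p ⊔ z)       ≡⟨ cong (x ∸_) (m≥n⇒m⊔n≡m (<⇒≤pred z<y)) ⟩
  x ∸ p             ≡⟨ cong (_∸ suc p) (+-comm 1 x) ⟩
  x + 1 ∸ suc p     ≡⟨ +-∸-comm 1 y≤x ⟩
  x ∸ suc p + 1     ≡⟨ cong (λ t → x ∸ t + 1) (sym (m≥n⇒m⊔n≡m (<⇒≤ z<y))) ⟩
  x ∸ (suc p ⊔ z) + 1 ≡⟨ cong (λ b → x ∸ (suc p ⊔ z) + bit b) (sym (dec-true (z <? suc p) z<y)) ⟩
  x ∸ (suc p ⊔ z) + bit (does (z <? suc p)) ∎
  where open ≡-Reasoning
... | no z≮y = begin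
  x ∸ (p ⊔ z)       ≡⟨ cong (x ∸_) (m≤n⇒m⊔n≡n (≤-trans (n≤1+n p) y≤z)) ⟩
  x ∸ z             ≡⟨ sym (+-identityʳ (x ∸ z)) ⟩
  x ∸ z + 0         ≡⟨ cong (λ t → x ∸ t + 0) (sym (m≤n⇒m⊔n≡n y≤z)) ⟩
  x ∸ (suc p ⊔ z) + 0 ≡⟨ cong (λ b → x ∸ (suc p ⊔ z) + bit b) (sym (dec-false (z <? suc p) z≮y)) ⟩
  x ∸ (suc p ⊔ z) + bit (does (z <? suc p)) ∎
  where open ≡-Reasoning
        y≤z = ≮⇒≥ z≮y

last-of-run : ∀ {P : ℕ → Set} → (∀ i → Dec (P i)) → ∀ L → (∀ i → L ≤ i → ¬ P i) →
  ∀ {k} → P k → ∃ λ j → P j × ¬ P (suc j)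
last-of-run {P} P? L beyond {k} pk = go (L ∸ k) k (m≤n+m∸n L k) pk
  where
  go : ∀ d k → L ≤ k + d → P k → ∃ λ j → P j × ¬ P (suc j)
  go zero    k L≤k pk = ⊥-elim (beyond k (subst (L ≤_) (+-identityʳ k) L≤k) pk)
  go (suc d) k L≤k pk with P? (suc k)
  ... | no ¬p = k , pk , ¬p
  ... | yes p = go d (suc k) (subst (L ≤_) (+-suc k d) L≤k) p

-- Removing cells from the rows of a skew shape

-- Rows are indexed from the top; f and g are the row lengths of ν and μ. On the boundary of ν/μ,
-- eastRun f g k is the east run under the end of row k and northRun f g k the north run following it,
-- which climbs as long as Joined holds: rows k and k + 1 end in the same column, outside μ.
eastRun : (f g : ℕ → ℕ) → ℕ → ℕ
eastRun f g k = f k ∸ (f (suc k) ⊔ g k)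

Removable : (f g : ℕ → ℕ) → ℕ → Set
Removable f g k = 0 < eastRun f g k

Joined : (f g : ℕ → ℕ) → ℕ → Set
Joined f g k = f k ≡ f (suc k) × g k < f (suc k)

joined? : ∀ f g k → Dec (Joined f g k)
joined? f g k = f k ≟ f (suc k) ×-dec g k <? f (suc k)

northRun : (f g : ℕ → ℕ) → ℕ → ℕ
northRun f g zero = 1
northRun f g (suc k) with joined? f g k
... | yes _ = suc (northRun f g k)
... | no _  = 1

oddPair : (f g : ℕ → ℕ) → ℕ → Bool
oddPair f g k = odd? (eastRun f g k) ∧ odd? (northRun f g k)

NoOddPair : (f g : ℕ → ℕ) → Set
NoOddPair f g = ∀ k → oddPair f g k ≡ false

remove : (ℕ → ℕ) → (ℕ → Bool) → ℕ → ℕ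
remove f s i = f i ∸ bit (s i)

-- Whether removing the rows in s, but not row k, lengthens the east or the north run at row k.
eastGrows : (f g : ℕ → ℕ) → (ℕ → Bool) → ℕ → Bool
eastGrows f g s k = s (suc k) ∧ does (g k <? f (suc k))

northGrows : (f g : ℕ → ℕ) → (ℕ → Bool) → ℕ → Bool
northGrows f g s zero = false
northGrows f g s (suc k) with joined? f g k
... | yes _ = northGrows f g s k
... | no _  = does (joined? (remove f s) g k)

eastIfKept : (f g : ℕ → ℕ) → (ℕ → Bool) → ℕ → ℕ
eastIfKept f g s k = eastRun f g k + bit (eastGrows f g s k)

northIfKept : (f g : ℕ → ℕ) → (ℕ → Bool) → ℕ → ℕ
northIfKept f g s k = northRun f g k + bit (northGrows f g s k)

-- oddPair (remove f s) g k when row k is kept (oddPair-kept).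
oddPairIfKept : (f g : ℕ → ℕ) → (ℕ → Bool) → ℕ → Bool
oddPairIfKept f g s k = odd? (eastIfKept f g s k) ∧ odd? (northIfKept f g s k)

IsFixed : (f g : ℕ → ℕ) → (ℕ → Bool) → Set
IsFixed f g s = ∀ k → Removable f g k → s k ≡ oddPairIfKept f g s k

module _ (f g : ℕ → ℕ) where

  removable-intro : ∀ {k} → f (suc k) < f k → g k < f k → Removable f g k
  removable-intro f↓ g< = m<n⇒0<n∸m (⊔-lub f↓ g<)

  removable⇒descent : ∀ {k} → Removable f g k → f (suc k) < f k
  removable⇒descent {k} r = ≤-<-trans (m≤m⊔n (f (suc k)) (g k)) (m∸n≢0⇒n<m (>⇒≢ r))

  removable⇒above : ∀ {k} → Removable f g k → g k < f k
  removable⇒above {k} r = ≤-<-trans (m≤n⊔m (f (suc k)) (g k)) (m∸n≢0⇒n<m (>⇒≢ r))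

  removable⇒positive : ∀ {k} → Removable f g k → 0 < f k
  removable⇒positive r = ≤-<-trans z≤n (removable⇒descent r)

  oddPair⇒removable : ∀ {k} → oddPair f g k ≡ true → Removable f g k
  oddPair⇒removable e = n≢0⇒n>0 λ east≡0 → true≢false (trans (sym (∧-true-left e)) (cong odd? east≡0))

  joined⇒eastRun≡0 : ∀ {k} → Joined f g k → eastRun f g k ≡ 0
  joined⇒eastRun≡0 {k} (f≡ , _) = m≤n⇒m∸n≡0 (≤-trans (≤-reflexive f≡) (m≤m⊔n (f (suc k)) (g k)))

  joined⇒¬removable : ∀ {k} → Joined f g k → ¬ Removable f g k
  joined⇒¬removable j r = <⇒≢ r (sym (joined⇒eastRun≡0 j))

  eastRun≡0⇒joined : ∀ {k} → f (suc k) ≤ f k → eastRun f g k ≡ 0 → g k < f (suc k) → Joined f g k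
  eastRun≡0⇒joined f↓ e0 g< =
    ≤-antisym (≤-trans (m∸n≡0⇒m≤n e0) (≤-reflexive (m≥n⇒m⊔n≡m (<⇒≤ g<)))) f↓ , g<

  northRun-joined : ∀ {k} → Joined f g k → northRun f g (suc k) ≡ suc (northRun f g k)
  northRun-joined {k} j with joined? f g k
  ... | yes _ = refl
  ... | no ¬j = ⊥-elim (¬j j)

  northRun-unjoined : ∀ {k} → ¬ Joined f g k → northRun f g (suc k) ≡ 1
  northRun-unjoined {k} ¬j with joined? f g k
  ... | yes j = ⊥-elim (¬j j)
  ... | no _  = refl

  eastGrows-true : ∀ s {k} → eastGrows f g s k ≡ true → s (suc k) ≡ true × g k < f (suc k)
  eastGrows-true s {k} e = ∧-true-left e , does≡true⇒ (g k <? f (suc k)) (∧-true-right e)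

  northGrows-joined : ∀ s {k} → Joined f g k → northGrows f g s (suc k) ≡ northGrows f g s k
  northGrows-joined s {k} j with joined? f g k
  ... | yes _ = refl
  ... | no ¬j = ⊥-elim (¬j j)

  northGrows-unjoined : ∀ s {k} → ¬ Joined f g k → northGrows f g s (suc k) ≡ does (joined? (remove f s) g k)
  northGrows-unjoined s {k} ¬j with joined? f g k
  ... | yes j = ⊥-elim (¬j j)
  ... | no _  = refl

  northIfKept-joined : ∀ s {k} → Joined f g k → northIfKept f g s (suc k) ≡ suc (northIfKept f g s k)
  northIfKept-joined s j = cong₂ _+_ (northRun-joined j) (cong bit (northGrows-joined s j))

Joined-cong : ∀ h h′ g {k} → h k ≡ h′ k → h (suc k) ≡ h′ (suc k) → Joined h g k → Joined h′ g k
Joined-cong h h′ g {k} e e′ (h≡ , g<) = trans (sym e) (trans h≡ e′) , subst (g k <_) e′ g<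

remove-kept : ∀ f s {i} → s i ≡ false → remove f s i ≡ f i
remove-kept f s {i} e = cong (λ b → f i ∸ bit b) e

remove-removed : ∀ f s {i} → s i ≡ true → remove f s i ≡ f i ∸ 1
remove-removed f s {i} e = cong (λ b → f i ∸ bit b) e

removed-below⇒unjoined : ∀ f g s {j} → f (suc j) ≤ f j → (s j ≡ true → Removable f g j) →
  Removable f g (suc j) → s (suc j) ≡ true → ¬ Joined (remove f s) g j
removed-below⇒unjoined f g s {j} f↓ valid-j r s₁ (same , _) with s j in s₀
... | false = <-irrefl refl (<-≤-trans (subst (_< f (suc j)) (sym fj≡) (n∸1<n (removable⇒positive f g r))) f↓)
  where
  fj≡ : f j ≡ f (suc j) ∸ 1
  fj≡ = trans same (remove-removed f s s₁)
... | true = <-irrefl (sym fj≡) (removable⇒descent f g (valid-j refl))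
  where
  0<f₁ = removable⇒positive f g r
  fj≡ : f j ≡ f (suc j)
  fj≡ = ∸-cancelʳ-≡ (≤-trans 0<f₁ f↓) 0<f₁ (trans same (remove-removed f s s₁))

module Removal (f g : ℕ → ℕ) (f-anti : ∀ i → f (suc i) ≤ f i) (s : ℕ → Bool)
               (valid : ∀ i → s i ≡ true → Removable f g i) where

  f′ : ℕ → ℕ
  f′ = remove f s

  joined⇒kept : ∀ {k} → Joined f g k → s k ≡ false
  joined⇒kept {k} j with s k in sk
  ... | false = refl
  ... | true  = ⊥-elim (joined⇒¬removable f g j (valid k sk))

  removed-below⇒unjoined′ : ∀ {j} → s (suc j) ≡ true → ¬ Joined f′ g j
  removed-below⇒unjoined′ {j} s₁ =
    removed-below⇒unjoined f g s (f-anti j) (valid j) (valid (suc j) s₁) s₁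

  joined⇒joined′ : ∀ {j} → Joined f g j → s (suc j) ≡ false → Joined f′ g j
  joined⇒joined′ j s₁ = Joined-cong f f′ g (sym (remove-kept f s (joined⇒kept j))) (sym (remove-kept f s s₁)) j

  newly-joined⇒removed : ∀ {j} → Joined f′ g j → ¬ Joined f g j → s j ≡ true
  newly-joined⇒removed {j} j′ ¬j with true-or-false (s j) | true-or-false (s (suc j))
  ... | inj₁ s₀ | _       = s₀
  ... | inj₂ s₀ | inj₁ s₁ = ⊥-elim (removed-below⇒unjoined′ s₁ j′)
  ... | inj₂ s₀ | inj₂ s₁ = ⊥-elim (¬j (Joined-cong f′ f g (remove-kept f s s₀) (remove-kept f s s₁) j′))

  northGrows⇒newly-joined : ∀ k → northGrows f g s k ≡ true →
    ∃ λ i → i < k × ¬ Joined f g i × Joined f′ g i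
  northGrows⇒newly-joined (suc k) grows with joined? f g k
  ... | yes _ = let i , i<k , ¬j , j′ = northGrows⇒newly-joined k grows in i , m<n⇒m<1+n i<k , ¬j , j′
  ... | no ¬j = k , n<1+n k , ¬j , does≡true⇒ (joined? f′ g k) grows

  eastRun-removed-below : ∀ k → f k ∸ (f′ (suc k) ⊔ g k) ≡ eastIfKept f g s k
  eastRun-removed-below k with s (suc k) in s₁
  ... | false = sym (+-identityʳ _)
  ... | true  = ∸-pred⊔ (f k) (f (suc k)) (g k) (removable⇒positive f g (valid (suc k) s₁)) (f-anti k)

  eastRun-removal : ∀ k → eastRun f′ g k ≡ eastIfKept f g s k ∸ bit (s k)
  eastRun-removal k =
    trans ([m∸n]∸o≡[m∸o]∸n (f k) (bit (s k)) (f′ (suc k) ⊔ g k))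
          (cong (_∸ bit (s k)) (eastRun-removed-below k))

  northRun-removed : ∀ {k} → s k ≡ true → northRun f′ g k ≡ 1
  northRun-removed {zero}  _  = refl
  northRun-removed {suc j} s₁ = northRun-unjoined f′ g (removed-below⇒unjoined′ s₁)

  northRun-kept : ∀ {k} → s k ≡ false → northRun f′ g k ≡ northIfKept f g s k
  northRun-kept {zero}  _  = refl
  northRun-kept {suc j} s₁ with joined? f g j
  ... | yes j = trans (northRun-joined f′ g (joined⇒joined′ j s₁)) (cong suc (northRun-kept (joined⇒kept j)))
  ... | no ¬j with joined? f′ g j
  ...   | yes j′ = cong suc (trans (northRun-removed (newly-joined⇒removed j′ ¬j))
                                  (cong bit (sym (dec-true (joined? f′ g j) j′))))
  ...   | no ¬j′ = cong (λ b → 1 + bit b) (sym (dec-false (joined? f′ g j) ¬j′))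

  oddPair-kept : ∀ {k} → s k ≡ false → oddPair f′ g k ≡ oddPairIfKept f g s k
  oddPair-kept {k} sk = cong₂ (λ a b → odd? a ∧ odd? b)
    (trans (eastRun-removal k) (cong (λ b → eastIfKept f g s k ∸ bit b) sk)) (northRun-kept sk)

  oddPair-removed : ∀ {k} → s k ≡ true → oddPair f′ g k ≡ not (odd? (eastIfKept f g s k))
  oddPair-removed {k} sk = begin
    odd? (eastRun f′ g k) ∧ odd? (northRun f′ g k)
      ≡⟨ cong₂ (λ a b → odd? a ∧ odd? b)
           (trans (eastRun-removal k) (cong (λ b → eastIfKept f g s k ∸ bit b) sk)) (northRun-removed sk) ⟩
    odd? (eastIfKept f g s k ∸ 1) ∧ true  ≡⟨ ∧-identityʳ _ ⟩
    odd? (eastIfKept f g s k ∸ 1)         ≡⟨ odd?-pred (≤-trans (valid k sk) (m≤m+n _ _)) ⟩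
    not (odd? (eastIfKept f g s k))       ∎
    where open ≡-Reasoning

  eastRun≡0⇒oddPairIfKept≡false : IsFixed f g s → ∀ {k} → eastRun f g k ≡ 0 → oddPairIfKept f g s k ≡ false
  eastRun≡0⇒oddPairIfKept≡false fixed {k} east≡0 with true-or-false (eastGrows f g s k)
  ... | inj₂ e = cong₂ (λ a b → odd? (a + bit b) ∧ odd? (northIfKept f g s k)) east≡0 e
  ... | inj₁ e = trans (cong (odd? (eastIfKept f g s k) ∧_) evenNorth) (∧-zeroʳ _)
    where
    s₁ = proj₁ (eastGrows-true f g s e)
    joined = eastRun≡0⇒joined f g (f-anti k) east≡0 (proj₂ (eastGrows-true f g s e))
    evenNorth : odd? (northIfKept f g s k) ≡ false
    evenNorth = not≡true (trans (cong odd? (sym (northIfKept-joined f g s joined)))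
                                (∧-true-right (trans (sym (fixed (suc k) (valid (suc k) s₁))) s₁)))

  fixed⇒noOddPair : IsFixed f g s → NoOddPair f′ g
  fixed⇒noOddPair fixed k with true-or-false (s k)
  ... | inj₁ sk = trans (oddPair-removed sk) (cong not (∧-true-left (trans (sym (fixed k (valid k sk))) sk)))
  ... | inj₂ sk with 0 <? eastRun f g k
  ...   | yes r = trans (oddPair-kept sk) (trans (sym (fixed k r)) sk)
  ...   | no ¬r = trans (oddPair-kept sk) (eastRun≡0⇒oddPairIfKept≡false fixed (n≤0⇒n≡0 (≮⇒≥ ¬r)))

  joined′⇒kept-below : ∀ {i} → Joined f′ g i → s (suc i) ≡ false
  joined′⇒kept-below {i} j′ with true-or-false (s (suc i))
  ... | inj₁ s₁ = ⊥-elim (removed-below⇒unjoined′ s₁ j′)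
  ... | inj₂ s₁ = s₁

  module _ (noOdd : NoOddPair f g) (noOdd′ : NoOddPair f′ g) where

    removed⇒oddEastIfKept : ∀ {k} → s k ≡ true → odd? (eastIfKept f g s k) ≡ true
    removed⇒oddEastIfKept {k} sk = not≡false (trans (sym (oddPair-removed sk)) (noOdd′ k))

    removed-below-joined⇒oddNorthIfKept : ∀ {j} → Joined f g j → s (suc j) ≡ true →
      odd? (northIfKept f g s (suc j)) ≡ true
    removed-below-joined⇒oddNorthIfKept {j} joined s₁ =
      trans (cong odd? (northIfKept-joined f g s joined)) (cong not evenNorth)
      where
      grows : eastGrows f g s j ≡ true
      grows = cong₂ _∧_ s₁ (dec-true (g j <? f (suc j)) (proj₂ joined))
      evenNorth : odd? (northIfKept f g s j) ≡ false
      evenNorth = trans (cong₂ (λ a b → odd? (a + bit b) ∧ odd? (northIfKept f g s j))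
                               (sym (joined⇒eastRun≡0 f g joined)) (sym grows))
                        (trans (sym (oddPair-kept (joined⇒kept joined))) (noOdd′ j))

    removed-above-kept⇒evenNorth : ∀ {k} → s k ≡ true → s (suc k) ≡ false → odd? (northRun f g k) ≡ false
    removed-above-kept⇒evenNorth {k} sk s₁ = trans (cong (_∧ odd? (northRun f g k)) (sym oddEast)) (noOdd k)
      where
      oddEast : odd? (eastRun f g k) ≡ true
      oddEast = trans (cong odd? (sym (+-identityʳ (eastRun f g k))))
                      (trans (cong (λ b → odd? (eastRun f g k + bit (b ∧ does (g k <? f (suc k))))) (sym s₁))
                             (removed⇒oddEastIfKept sk))

    no-removed-above-kept : ∀ k → s k ≡ true → s (suc k) ≡ false → ⊥
    no-removed-above-kept = <-rec (λ k → s k ≡ true → s (suc k) ≡ false → ⊥) step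
      where
      step : ∀ k → (∀ {i} → i < k → s i ≡ true → s (suc i) ≡ false → ⊥) →
             s k ≡ true → s (suc k) ≡ false → ⊥
      step zero    _   sk s₁ = true≢false (removed-above-kept⇒evenNorth sk s₁)
      step (suc j) rec sk s₁ with joined? f g j
      ... | no ¬joined = true≢false (trans (cong odd? (sym (northRun-unjoined f g ¬joined)))
                                           (removed-above-kept⇒evenNorth sk s₁))
      ... | yes joined with true-or-false (northGrows f g s (suc j))
      ...   | inj₂ kept = true≢false
                (trans (sym (removed-below-joined⇒oddNorthIfKept joined sk))
                       (trans (cong (λ b → odd? (northRun f g (suc j) + bit b)) kept)
                              (trans (cong odd? (+-identityʳ (northRun f g (suc j))))
                                     (removed-above-kept⇒evenNorth sk s₁))))
      ...   | inj₁ grows =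
        let i , i<k , ¬joined , joined′ = northGrows⇒newly-joined (suc j) grows
        in rec i<k (newly-joined⇒removed joined′ ¬joined) (joined′⇒kept-below joined′)

  removed⇒below : ∀ L → (∀ i → L ≤ i → f i ≡ 0) → ∀ {i} → s i ≡ true → i < L
  removed⇒below L f-beyond {i} si with i <? L
  ... | yes i<L = i<L
  ... | no i≮L  = ⊥-elim (<⇒≢ (removable⇒positive f g (valid i si)) (sym (f-beyond i (≮⇒≥ i≮L))))

northRun-cong : ∀ h h′ g → (∀ i → h i ≡ h′ i) → ∀ k → northRun h g k ≡ northRun h′ g k
northRun-cong h h′ g h≗h′ zero = refl
northRun-cong h h′ g h≗h′ (suc k) with joined? h g k | joined? h′ g k
... | yes _ | yes _  = cong suc (northRun-cong h h′ g h≗h′ k)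
... | no _  | no _   = refl
... | yes j | no ¬j′ = ⊥-elim (¬j′ (Joined-cong h h′ g (h≗h′ k) (h≗h′ (suc k)) j))
... | no ¬j | yes j′ = ⊥-elim (¬j (Joined-cong h′ h g (sym (h≗h′ k)) (sym (h≗h′ (suc k))) j′))

NoOddPair-cong : ∀ h h′ g → (∀ i → h i ≡ h′ i) → NoOddPair h g → NoOddPair h′ g
NoOddPair-cong h h′ g h≗h′ noOdd k = trans (sym same) (noOdd k)
  where
  same : oddPair h g k ≡ oddPair h′ g k
  same = cong₂ (λ a b → odd? a ∧ odd? b)
           (cong₂ (λ a b → a ∸ (b ⊔ g k)) (h≗h′ k) (h≗h′ (suc k))) (northRun-cong h h′ g h≗h′ k)

set : (ℕ → Bool) → ℕ → Bool → ℕ → Bool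
set s K b i with i ≟ K
... | yes _ = b
... | no _  = s i

set-same : ∀ s K b → set s K b K ≡ b
set-same s K b with K ≟ K
... | yes _ = refl
... | no K≢K = ⊥-elim (K≢K refl)

set-other : ∀ s K b {i} → i ≢ K → set s K b i ≡ s i
set-other s K b {i} i≢K with i ≟ K
... | yes i≡K = ⊥-elim (i≢K i≡K)
... | no _    = refl

module FixedPoint (f g : ℕ → ℕ) (f-anti : ∀ i → f (suc i) ≤ f i) where

  northGrows-local : ∀ s s′ k → (∀ i → i ≤ k → s i ≡ s′ i) → northGrows f g s k ≡ northGrows f g s′ k
  northGrows-local s s′ zero    _     = refl
  northGrows-local s s′ (suc k) agree with joined? f g k
  ... | yes _ = northGrows-local s s′ k (λ i i≤k → agree i (m≤n⇒m≤1+n i≤k))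
  ... | no _  = cong₂ (λ a b → does (a ≟ b) ∧ does (g k <? b))
                  (cong (λ c → f k ∸ bit c) (agree k (n≤1+n k)))
                  (cong (λ c → f (suc k) ∸ bit c) (agree (suc k) ≤-refl))

  oddPairIfKept-local : ∀ s s′ k → (∀ i → i ≤ suc k → s i ≡ s′ i) →
    oddPairIfKept f g s k ≡ oddPairIfKept f g s′ k
  oddPairIfKept-local s s′ k agree = cong₂ (λ a b → odd? (eastRun f g k + bit (a ∧ does (g k <? f (suc k))))
                                                   ∧ odd? (northRun f g k + bit b))
    (agree (suc k) ≤-refl) (northGrows-local s s′ k (λ i i≤k → agree i (m≤n⇒m≤1+n i≤k)))

  eastIfKept-set : ∀ s s′ K b → eastIfKept f g (set s (suc K) b) K ≡ eastIfKept f g (set s′ (suc K) b) K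
  eastIfKept-set s s′ K b = cong (λ c → eastRun f g K + bit (c ∧ does (g K <? f (suc K))))
                                 (trans (set-same s (suc K) b) (sym (set-same s′ (suc K) b)))

  -- oddPairIfKept at row i reads s only at rows ≤ i + 1, so a sequence that is a fixed point above row K
  -- stays one whatever happens below row K; row K itself is settled only once row K + 1 is chosen.
  record Prefix (K : ℕ) (b : Bool) : Set where
    field
      seq        : ℕ → Bool
      seq-K      : seq K ≡ b
      seq-beyond : ∀ i → K < i → seq i ≡ false
      valid      : ∀ i → i < K → seq i ≡ true → Removable f g i
      fixed      : ∀ i → i < K → Removable f g i → seq i ≡ oddPairIfKept f g seq i
  open Prefix

  extend : ∀ {K c} b (S : Prefix K c) → (c ≡ true → Removable f g K) →
           (Removable f g K → c ≡ oddPairIfKept f g (set (seq S) (suc K) b) K) → Prefix (suc K) b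
  extend {K} {c} b S validK fixedK = record
    { seq        = s′
    ; seq-K      = set-same (seq S) (suc K) b
    ; seq-beyond = λ i K+1<i → trans (set-other (seq S) (suc K) b (>⇒≢ K+1<i))
                                      (seq-beyond S i (<-trans (n<1+n K) K+1<i))
    ; valid      = valid′
    ; fixed      = fixed′
    }
    where
    s′ = set (seq S) (suc K) b
    agree : ∀ i → i ≤ K → s′ i ≡ seq S i
    agree i i≤K = set-other (seq S) (suc K) b (<⇒≢ (s≤s i≤K))
    valid′ : ∀ i → i < suc K → s′ i ≡ true → Removable f g i
    valid′ i (s≤s i≤K) e with m≤n⇒m<n∨m≡n i≤K
    ... | inj₁ i<K  = valid S i i<K (trans (sym (agree i i≤K)) e)
    ... | inj₂ refl = validK (trans (sym (seq-K S)) (trans (sym (agree i i≤K)) e))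
    fixed′ : ∀ i → i < suc K → Removable f g i → s′ i ≡ oddPairIfKept f g s′ i
    fixed′ i (s≤s i≤K) r with m≤n⇒m<n∨m≡n i≤K
    ... | inj₁ i<K  = trans (agree i i≤K) (trans (fixed S i i<K r)
                        (oddPairIfKept-local (seq S) s′ i (λ j j≤ → sym (agree j (≤-trans j≤ i<K)))))
    ... | inj₂ refl = trans (agree i i≤K) (trans (seq-K S) (fixedK r))

  flip : ∀ {j} → Joined f g j → Prefix (suc j) false → Prefix (suc j) true
  flip {j} joined S = record
    { seq        = s′
    ; seq-K      = set-same (seq S) (suc j) true
    ; seq-beyond = λ i j+1<i → trans (set-other (seq S) (suc j) true (>⇒≢ j+1<i)) (seq-beyond S i j+1<i)
    ; valid      = λ i i≤j e → valid S i i≤j (trans (sym (agree i≤j)) e)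
    ; fixed      = fixed′
    }
    where
    s′ = set (seq S) (suc j) true
    agree : ∀ {i} → i < suc j → s′ i ≡ seq S i
    agree i≤j = set-other (seq S) (suc j) true (<⇒≢ i≤j)
    fixed′ : ∀ i → i < suc j → Removable f g i → s′ i ≡ oddPairIfKept f g s′ i
    fixed′ i (s≤s i≤j) r with m≤n⇒m<n∨m≡n i≤j
    ... | inj₁ i<j  = trans (agree (s≤s i≤j)) (trans (fixed S i (s≤s i≤j) r)
                        (oddPairIfKept-local (seq S) s′ i (λ k k≤ → sym (agree (s≤s (≤-trans k≤ i<j))))))
    ... | inj₂ refl = ⊥-elim (joined⇒¬removable f g joined r)

  raise-top : ∀ K b (S₀ : Prefix K false) (S₁ : Prefix K true) → northRun f g K ≡ 1 →
    northGrows f g (set (seq S₁) (suc K) b) K ≡ false →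
    oddPairIfKept f g (set (seq S₀) (suc K) b) K ≡ true → oddPairIfKept f g (set (seq S₁) (suc K) b) K ≡ true
  raise-top K b S₀ S₁ one grows wish = begin
    odd? (eastIfKept f g s₁ K) ∧ odd? (northRun f g K + bit (northGrows f g s₁ K))
      ≡⟨ cong₂ (λ a c → odd? (eastIfKept f g s₁ K) ∧ odd? (a + bit c)) one grows ⟩
    odd? (eastIfKept f g s₁ K) ∧ true ≡⟨ ∧-identityʳ _ ⟩
    odd? (eastIfKept f g s₁ K)        ≡⟨ cong odd? (eastIfKept-set (seq S₁) (seq S₀) K b) ⟩
    odd? (eastIfKept f g s₀ K)        ≡⟨ ∧-true-left wish ⟩
    true                              ∎
    where
    open ≡-Reasoning
    s₀ = set (seq S₀) (suc K) b
    s₁ = set (seq S₁) (suc K) b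

  -- If row K continues a joined block, flipping row K disturbs no condition above it, as row K − 1 is
  -- not removable; otherwise the wish at row K depends only on row K + 1.
  raise : ∀ K b (S₀ : Prefix K false) → Prefix K true → Removable f g K →
          oddPairIfKept f g (set (seq S₀) (suc K) b) K ≡ true →
          Σ (Prefix K true) λ S → oddPairIfKept f g (set (seq S) (suc K) b) K ≡ true
  raise zero    b S₀ S₁ r wish = S₁ , raise-top zero b S₀ S₁ refl refl wish
  raise (suc j) b S₀ S₁ r wish = by-cases (joined? f g j)
    where
    K = suc j
    by-cases : Dec (Joined f g j) → Σ (Prefix K true) λ S → oddPairIfKept f g (set (seq S) (suc K) b) K ≡ true
    by-cases (yes joined) = S , trans same wish
      where
      S = flip joined S₀
      s  = set (seq S) (suc K) b
      s₀ = set (seq S₀) (suc K) b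
      agree : ∀ i → i ≤ j → s i ≡ s₀ i
      agree i i≤j = trans (set-other (seq S) (suc K) b (<⇒≢ (s≤s (m≤n⇒m≤1+n i≤j))))
                   (trans (set-other (seq S₀) K true (<⇒≢ (s≤s i≤j)))
                          (sym (set-other (seq S₀) (suc K) b (<⇒≢ (s≤s (m≤n⇒m≤1+n i≤j))))))
      same : oddPairIfKept f g s K ≡ oddPairIfKept f g s₀ K
      same = cong₂ (λ a c → odd? a ∧ odd? (northRun f g K + bit c)) (eastIfKept-set (seq S) (seq S₀) K b)
               (trans (northGrows-joined f g s joined)
                      (trans (northGrows-local s s₀ j agree) (sym (northGrows-joined f g s₀ joined))))
    by-cases (no ¬joined) = S₁ , raise-top K b S₀ S₁ (northRun-unjoined f g ¬joined) grows wish
      where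
      s = set (seq S₁) (suc K) b
      s-K : s K ≡ true
      s-K = trans (set-other (seq S₁) (suc K) b (<⇒≢ ≤-refl)) (seq-K S₁)
      valid-j : s j ≡ true → Removable f g j
      valid-j e = valid S₁ j ≤-refl (trans (sym (set-other (seq S₁) (suc K) b (<⇒≢ (m≤n⇒m≤1+n ≤-refl)))) e)
      grows : northGrows f g s K ≡ false
      grows = trans (northGrows-unjoined f g s ¬joined)
                    (dec-false (joined? (remove f s) g j) (removed-below⇒unjoined f g s (f-anti j) valid-j r s-K))

  prefix : ∀ K b → Prefix K b
  prefix zero b = record
    { seq        = set (λ _ → false) 0 b
    ; seq-K      = set-same (λ _ → false) 0 b
    ; seq-beyond = λ i 0<i → set-other (λ _ → false) 0 b (>⇒≢ 0<i)
    ; valid      = λ _ ()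
    ; fixed      = λ _ ()
    }
  prefix (suc K) b with 0 <? eastRun f g K | true-or-false (oddPairIfKept f g (set (seq (prefix K false)) (suc K) b) K)
  ... | no ¬r | _         = extend b (prefix K false) (λ ()) (λ r → ⊥-elim (¬r r))
  ... | yes r | inj₂ kept = extend b (prefix K false) (λ ()) (λ _ → sym kept)
  ... | yes r | inj₁ wish = let S , wish′ = raise K b (prefix K false) (prefix K true) r wish
                            in extend b S (λ _ → r) (λ _ → sym wish′)

  fixedPoint : ∀ L → (∀ i → L ≤ i → f i ≡ 0) →
    Σ (ℕ → Bool) λ s → (∀ i → s i ≡ true → Removable f g i) × IsFixed f g s
  fixedPoint L f-beyond = seq S , valid′ , fixed′
    where
    S = prefix L false
    beyond : ∀ i → L ≤ i → seq S i ≡ false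
    beyond i L≤i with m≤n⇒m<n∨m≡n L≤i
    ... | inj₁ L<i  = seq-beyond S i L<i
    ... | inj₂ refl = seq-K S
    valid′ : ∀ i → seq S i ≡ true → Removable f g i
    valid′ i e with i <? L
    ... | yes i<L = valid S i i<L e
    ... | no i≮L  = ⊥-elim (true≢false (trans (sym e) (beyond i (≮⇒≥ i≮L))))
    fixed′ : IsFixed f g (seq S)
    fixed′ i r with i <? L
    ... | yes i<L = fixed S i i<L r
    ... | no i≮L  = ⊥-elim (<⇒≢ (removable⇒positive f g r) (sym (f-beyond i (≮⇒≥ i≮L))))

record CellRemoval (f g : ℕ → ℕ) : Set where
  field
    removed           : ℕ → Bool
    removed-removable : ∀ i → removed i ≡ true → Removable f g i
    witness           : ℕ
    witness-removed   : removed witness ≡ true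

module _ (f g : ℕ → ℕ) (f-anti : ∀ i → f (suc i) ≤ f i)
         (L : ℕ) (f-beyond : ∀ i → L ≤ i → f i ≡ 0) where
  open CellRemoval

  noOddPair⇒removal-breaks : NoOddPair f g → (R : CellRemoval f g) → ¬ NoOddPair (remove f (removed R)) g
  noOddPair⇒removal-breaks noOdd R noOdd′ =
    let j , sⱼ , ¬sⱼ₊₁ = last-of-run (λ i → removed R i Bool.≟ true) L
                           (λ i L≤i sᵢ → <⇒≱ (removed⇒below L f-beyond sᵢ) L≤i) (witness-removed R)
    in no-removed-above-kept noOdd noOdd′ j sⱼ (¬-not ¬sⱼ₊₁)
    where open Removal f g f-anti (removed R) (removed-removable R)

  oddPair⇒removal-repairs : ¬ NoOddPair f g → Σ (CellRemoval f g) λ R → NoOddPair (remove f (removed R)) g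
  oddPair⇒removal-repairs oddPair = by-cases (anyUpTo? (λ i → s i Bool.≟ true) L)
    where
    fp = FixedPoint.fixedPoint f g f-anti L f-beyond
    s = proj₁ fp
    valid = proj₁ (proj₂ fp)
    open Removal f g f-anti s valid
    noOdd′ : NoOddPair (remove f s) g
    noOdd′ = fixed⇒noOddPair (proj₂ (proj₂ fp))
    by-cases : Dec (∃ λ k → k < L × s k ≡ true) → Σ (CellRemoval f g) λ R → NoOddPair (remove f (removed R)) g
    by-cases (yes (k , _ , sk)) =
      record { removed = s ; removed-removable = valid ; witness = k ; witness-removed = sk } , noOdd′
    by-cases (no none) = ⊥-elim (oddPair (NoOddPair-cong (remove f s) f g (λ i → remove-kept f s (kept i)) noOdd′))
      where
      kept : ∀ i → s i ≡ false
      kept i = ¬-not λ si → none (i , removed⇒below L f-beyond si , si)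

-- The interval [μ, λ] as a position of the game

part-anti : ∀ {l} → IsPartition l → ∀ i → part l (suc i) ≤ part l i
part-anti {[]}          _                        _       = z≤n
part-anti {a ∷ []}      _                        _       = z≤n
part-anti {a ∷ b ∷ l}   (a≥b ∷ _ , _)           zero    = a≥b
part-anti {a ∷ b ∷ l}   (_ ∷ ordered , _ ∷ pos) (suc i) = part-anti (ordered , pos) i

part-beyond : ∀ l {i} → length l ≤ i → part l i ≡ 0
part-beyond []      _         = refl
part-beyond (a ∷ l) {suc i} (s≤s l≤i) = part-beyond l l≤i

part-positive : ∀ {l} → IsPartition l → ∀ {i} → i < length l → 0 < part l i
part-positive {a ∷ l}     (_ , a>0 ∷ _)           {zero}  _         = a>0
part-positive {a ∷ b ∷ l} (_ ∷ ordered , _ ∷ pos) {suc i} (s≤s i<l) = part-positive (ordered , pos) i<l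

positive⇒below-length : ∀ l {i} → 0 < part l i → i < length l
positive⇒below-length l {i} 0<lᵢ with i <? length l
... | yes i<L = i<L
... | no i≮L  = ⊥-elim (<⇒≢ 0<lᵢ (sym (part-beyond l (≮⇒≥ i≮L))))

IsPartition-tail : ∀ {a l} → IsPartition (a ∷ l) → IsPartition l
IsPartition-tail {l = []}    _                   = [] , []
IsPartition-tail {l = _ ∷ _} (_ ∷ ordered , _ ∷ pos) = ordered , pos

part≤sum : ∀ l i → part l i ≤ sum l
part≤sum []      i       = z≤n
part≤sum (a ∷ l) zero    = m≤m+n a (sum l)
part≤sum (a ∷ l) (suc i) = ≤-trans (part≤sum l i) (m≤n+m (sum l) a)

sum-mono : ∀ xs ys → (∀ i → part ys i ≤ part xs i) → sum ys ≤ sum xs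
sum-mono xs       []       _  = z≤n
sum-mono []       (b ∷ bs) ≤ᵢ = +-mono-≤ (≤ᵢ 0) (sum-mono [] bs (≤ᵢ ∘ suc))
sum-mono (a ∷ as) (b ∷ bs) ≤ᵢ = +-mono-≤ (≤ᵢ 0) (sum-mono as bs (≤ᵢ ∘ suc))

sum-strict : ∀ xs ys → (∀ i → part ys i ≤ part xs i) → ∀ k → part ys k < part xs k → sum ys < sum xs
sum-strict xs       []       _  k       <ₖ = <-≤-trans <ₖ (part≤sum xs k)
sum-strict []       (b ∷ bs) _  k       <ₖ = ⊥-elim (n≮0 <ₖ)
sum-strict (a ∷ as) (b ∷ bs) ≤ᵢ zero    <ₖ = +-mono-<-≤ <ₖ (sum-mono as bs (≤ᵢ ∘ suc))
sum-strict (a ∷ as) (b ∷ bs) ≤ᵢ (suc k) <ₖ = +-mono-≤-< (≤ᵢ 0) (sum-strict as bs (≤ᵢ ∘ suc) k <ₖ)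

-- cons⁺ drops a row emptied by the removal; only the last row can become empty (shrink-last).
cons⁺ : ℕ → List ℕ → List ℕ
cons⁺ zero    l = l
cons⁺ (suc a) l = suc a ∷ l

shrink : List ℕ → (ℕ → Bool) → List ℕ
shrink []      s = []
shrink (a ∷ l) s = cons⁺ (a ∸ bit (s 0)) (shrink l (s ∘ suc))

ShrinkableBy : List ℕ → (ℕ → Bool) → Set
ShrinkableBy l s = ∀ i → s i ≡ true → part l (suc i) < part l i

shrinkable⇒next≤ : ∀ {l s} → IsPartition l → ShrinkableBy l s →
  ∀ i → part l (suc i) ≤ part l i ∸ bit (s i)
shrinkable⇒next≤ {l} {s} pl shrinkable i with true-or-false (s i)
... | inj₁ si = subst (λ b → part l (suc i) ≤ part l i ∸ bit b) (sym si) (<⇒≤pred (shrinkable i si))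
... | inj₂ si = subst (λ b → part l (suc i) ≤ part l i ∸ bit b) (sym si) (part-anti pl i)

shrink-last : ∀ {a l s} → IsPartition (a ∷ l) → ShrinkableBy (a ∷ l) s → a ∸ bit (s 0) ≡ 0 → l ≡ []
shrink-last {l = []}    _                     _          _      = refl
shrink-last {a} {c ∷ l} {s} (_ , a>0 ∷ c>0 ∷ _) shrinkable a∸b≡0 with s 0 in s₀
... | false = ⊥-elim (<⇒≢ a>0 (sym a∸b≡0))
... | true  = ⊥-elim (n≮0 (<-≤-trans c>0 (≤-pred (<-≤-trans (shrinkable 0 s₀) (m∸n≡0⇒m≤n a∸b≡0)))))

part-shrink : ∀ l s → IsPartition l → ShrinkableBy l s → ∀ i → part (shrink l s) i ≡ part l i ∸ bit (s i)
part-shrink []      s _  _          i = sym (0∸n≡0 (bit (s i)))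
part-shrink (a ∷ l) s pl shrinkable i with a ∸ bit (s 0) in e
... | suc m = case i
  where
  case : ∀ i → part (suc m ∷ shrink l (s ∘ suc)) i ≡ part (a ∷ l) i ∸ bit (s i)
  case zero    = sym e
  case (suc i) = part-shrink l (s ∘ suc) (IsPartition-tail pl) (shrinkable ∘ suc) i
... | zero = subst (λ l → part (shrink l (s ∘ suc)) i ≡ part (a ∷ l) i ∸ bit (s i))
                   (sym (shrink-last pl shrinkable e)) (single-row i)
  where
  single-row : ∀ i → part [] i ≡ part (a ∷ []) i ∸ bit (s i)
  single-row zero    = sym e
  single-row (suc i) = sym (0∸n≡0 (bit (s (suc i))))

shrink-partition : ∀ l s → IsPartition l → ShrinkableBy l s → IsPartition (shrink l s)
shrink-partition []      s _  _          = [] , []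
shrink-partition (a ∷ l) s pl shrinkable with a ∸ bit (s 0) in e
... | suc m = linked (proj₁ rest) head≤ , s≤s z≤n ∷ proj₂ rest
  where
  pl′ = IsPartition-tail pl
  head≤ : part (shrink l (s ∘ suc)) 0 ≤ suc m
  head≤ = begin
    part (shrink l (s ∘ suc)) 0 ≡⟨ part-shrink l (s ∘ suc) pl′ (shrinkable ∘ suc) 0 ⟩
    part l 0 ∸ bit (s 1)        ≤⟨ m∸n≤m (part l 0) (bit (s 1)) ⟩
    part l 0                    ≤⟨ shrinkable⇒next≤ pl shrinkable 0 ⟩
    a ∸ bit (s 0)               ≡⟨ e ⟩
    suc m                       ∎
    where open ≤-Reasoning
  linked : ∀ {r} → Linked _≥_ r → part r 0 ≤ suc m → Linked _≥_ (suc m ∷ r)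
  linked {[]}    _       _   = [-]
  linked {_ ∷ _} ordered ≤hd = ≤hd ∷ ordered
  rest = shrink-partition l (s ∘ suc) pl′ (shrinkable ∘ suc)
... | zero = shrink-partition l (s ∘ suc) (IsPartition-tail pl) (shrinkable ∘ suc)

only : ℕ → ℕ → Bool
only k i = does (i ≟ k)

only-same : ∀ k → only k k ≡ true
only-same k = dec-true (k ≟ k) refl

only-other : ∀ {k i} → i ≢ k → only k i ≡ false
only-other {k} {i} i≢k = dec-false (i ≟ k) i≢k

only-true : ∀ {k i} → only k i ≡ true → i ≡ k
only-true {k} {i} = does≡true⇒ (i ≟ k)

∸-bit-anti : ∀ n {b c} → (b ≡ true → c ≡ true) → n ∸ bit c ≤ n ∸ bit b
∸-bit-anti n {false} {c}   _   = m∸n≤m n (bit c)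
∸-bit-anti n {true}  {c}   b⇒c = ≤-reflexive (cong (λ c → n ∸ bit c) (b⇒c refl))

module Young (μ λ′ : List ℕ) where
  open YoungUngar μ λ′

  I : Set
  I = Interval μ λ′

  _≼_ : I → I → Set
  x ≼ y = _≤I_ {μ} {λ′} x y

  rows : I → ℕ → ℕ
  rows x = part (proj₁ x)

  rows-anti : ∀ x i → rows x (suc i) ≤ rows x i
  rows-anti x = part-anti (proj₁ (proj₂ x))

  rows-beyond : ∀ x {i} → length (proj₁ x) ≤ i → rows x i ≡ 0
  rows-beyond x = part-beyond (proj₁ x)

  Corner : I → ℕ → Set
  Corner x = Removable (rows x) (part μ)

  shave : (x : I) (s : ℕ → Bool) → (∀ i → s i ≡ true → Corner x i) → I
  shave x s corners = shrink (proj₁ x) s , shrink-partition (proj₁ x) s px shrinkable , μ⊑ , ⊑λ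
    where
    px = proj₁ (proj₂ x)
    shrinkable : ShrinkableBy (proj₁ x) s
    shrinkable i si = removable⇒descent (rows x) (part μ) (corners i si)
    rows≡ = part-shrink (proj₁ x) s px shrinkable
    μ⊑ : μ ⊑ shrink (proj₁ x) s
    μ⊑ i with true-or-false (s i)
    ... | inj₁ si = subst (part μ i ≤_) (sym (trans (rows≡ i) (remove-removed (rows x) s si)))
                      (<⇒≤pred (removable⇒above (rows x) (part μ) (corners i si)))
    ... | inj₂ si = subst (part μ i ≤_) (sym (trans (rows≡ i) (remove-kept (rows x) s si)))
                      (proj₁ (proj₂ (proj₂ x)) i)
    ⊑λ : shrink (proj₁ x) s ⊑ λ′
    ⊑λ i = ≤-trans (≤-reflexive (rows≡ i))
                   (≤-trans (m∸n≤m (rows x i) (bit (s i))) (proj₂ (proj₂ (proj₂ x)) i))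

  rows-shave : ∀ x s corners i → rows (shave x s corners) i ≡ remove (rows x) s i
  rows-shave x s corners = part-shrink (proj₁ x) s (proj₁ (proj₂ x))
                             (λ i si → removable⇒descent (rows x) (part μ) (corners i si))

  shave-< : ∀ x s corners {k} → s k ≡ true → shave x s corners <P x
  shave-< x s corners {k} sk = shaved≤ , x≰shaved
    where
    shaved≤ : shave x s corners ≼ x
    shaved≤ i = ≤-trans (≤-reflexive (rows-shave x s corners i)) (m∸n≤m (rows x i) (bit (s i)))
    x≰shaved : ¬ (x ≼ shave x s corners)
    x≰shaved x≤ = <-irrefl refl (≤-<-trans (x≤ k)
      (subst (_< rows x k) (sym (trans (rows-shave x s corners k) (remove-removed (rows x) s sk)))
             (n∸1<n (removable⇒positive (rows x) (part μ) (corners k sk)))))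

  only-corners : ∀ x {k} → Corner x k → ∀ i → only k i ≡ true → Corner x i
  only-corners x c i e = subst (Corner x) (sym (only-true e)) c

  cover : (x : I) → ∀ {k} → Corner x k → I
  cover x {k} c = shave x (only k) (only-corners x c)

  rows-cover-same : ∀ x {k} (c : Corner x k) → rows (cover x c) k ≡ rows x k ∸ 1
  rows-cover-same x {k} c =
    trans (rows-shave x (only k) (only-corners x c) k) (remove-removed (rows x) (only k) (only-same k))

  rows-cover-other : ∀ x {k} (c : Corner x k) {i} → i ≢ k → rows (cover x c) i ≡ rows x i
  rows-cover-other x {k} c {i} i≢k =
    trans (rows-shave x (only k) (only-corners x c) i) (remove-kept (rows x) (only k) (only-other i≢k))

  cover-< : ∀ x {k} (c : Corner x k) → cover x c <P x
  cover-< x {k} c = shave-< x (only k) (only-corners x c) {k} (only-same k)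

  corner⇒covers : ∀ x {k} (c : Corner x k) → Covers x (cover x c)
  corner⇒covers x {k} c = cover-< x c , nothing-between
    where
    w = cover x c
    nothing-between : ∀ u → w <P u → u <P x → ⊥
    nothing-between u (w≤u , u≰w) (u≤x , x≰u) with rows u k ≟ rows x k
    ... | yes uₖ≡xₖ = x≰u x≤u
      where
      x≤u : x ≼ u
      x≤u i with i ≟ k
      ... | yes refl = ≤-reflexive (sym uₖ≡xₖ)
      ... | no i≢k   = subst (_≤ rows u i) (rows-cover-other x c i≢k) (w≤u i)
    ... | no uₖ≢xₖ = u≰w u≤w
      where
      u≤w : u ≼ w
      u≤w i with i ≟ k
      ... | yes refl = subst (rows u i ≤_) (sym (rows-cover-same x c)) (<⇒≤pred (≤∧≢⇒< (u≤x i) uₖ≢xₖ))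
      ... | no i≢k   = subst (rows u i ≤_) (sym (rows-cover-other x c i≢k)) (u≤x i)

  record CoverAt (x z : I) : Set where
    field
      row    : ℕ
      corner : Corner x row
      rows-≡ : ∀ i → rows z i ≡ rows (cover x corner) i

  covers⇒corner : ∀ x z → Covers x z → CoverAt x z
  covers⇒corner x z ((z≤x , x≰z) , nothing-between) = record
    { row = k ; corner = corner ; rows-≡ = λ i → ≤-antisym (z≤w i) (w≤z i) }
    where
    L = length (proj₁ x)
    below : ∀ {i} → rows z i < rows x i → i < L
    below {i} zᵢ<xᵢ with i <? L
    ... | yes i<L = i<L
    ... | no i≮L  = ⊥-elim (n≮0 (subst (rows z i <_) (rows-beyond x (≮⇒≥ i≮L)) zᵢ<xᵢ))
    some-lower : ∃ λ i → rows z i < rows x i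
    some-lower with anyUpTo? (λ i → rows z i <? rows x i) L
    ... | yes (i , _ , zᵢ<xᵢ) = i , zᵢ<xᵢ
    ... | no none = ⊥-elim (x≰z λ i → ≮⇒≥ λ zᵢ<xᵢ → none (i , below zᵢ<xᵢ , zᵢ<xᵢ))
    last = last-of-run (λ i → rows z i <? rows x i) L
                       (λ i L≤i zᵢ<xᵢ → <⇒≱ (below zᵢ<xᵢ) L≤i) (proj₂ some-lower)
    k = proj₁ last
    zₖ<xₖ = proj₁ (proj₂ last)
    corner : Corner x k
    corner = removable-intro (rows x) (part μ) x↓ (≤-<-trans (proj₁ (proj₂ (proj₂ z)) k) zₖ<xₖ)
      where
      x↓ : rows x (suc k) < rows x k
      x↓ = begin-strict
        rows x (suc k) ≤⟨ ≮⇒≥ (proj₂ (proj₂ last)) ⟩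
        rows z (suc k) ≤⟨ rows-anti z k ⟩
        rows z k       <⟨ zₖ<xₖ ⟩
        rows x k       ∎
        where open ≤-Reasoning
    w = cover x corner
    z≤w : z ≼ w
    z≤w i with i ≟ k
    ... | yes refl = subst (rows z i ≤_) (sym (rows-cover-same x corner)) (<⇒≤pred zₖ<xₖ)
    ... | no i≢k   = subst (rows z i ≤_) (sym (rows-cover-other x corner i≢k)) (z≤x i)
    w≤z : w ≼ z
    w≤z i = ≮⇒≥ λ zᵢ<wᵢ →
      nothing-between w (z≤w , λ w≤z → <⇒≱ zᵢ<wᵢ (w≤z i)) (cover-< x corner)

  module _ (x : I) where

    coverRows : ∀ {T} → All (Covers x) T → ℕ → Bool
    coverRows []                i = false
    coverRows {t ∷ _} (c ∷ cs) i = only (CoverAt.row (covers⇒corner x t c)) i ∨ coverRows cs i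

    coverRows-corner : ∀ {T} (A : All (Covers x) T) i → coverRows A i ≡ true → Corner x i
    coverRows-corner {t ∷ _} (c ∷ cs) i e with true-or-false (only (CoverAt.row (covers⇒corner x t c)) i)
    ... | inj₁ o = only-corners x (CoverAt.corner (covers⇒corner x t c)) i o
    ... | inj₂ o = coverRows-corner cs i (subst (λ b → b ∨ coverRows cs i ≡ true) o e)

    shaved-below-covers : ∀ {T} (A : All (Covers x) T) s corners →
      (∀ i → coverRows A i ≡ true → s i ≡ true) → All (shave x s corners ≼_) T
    shaved-below-covers []                 s corners _    = []
    shaved-below-covers {t ∷ _} (c ∷ cs) s corners incl = shaved≤t ∷ shaved-below-covers cs s corners incl′
      where
      open CoverAt (covers⇒corner x t c)
      incl′ : ∀ i → coverRows cs i ≡ true → s i ≡ true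
      incl′ i e = incl i (trans (cong (only row i ∨_) e) (∨-zeroʳ (only row i)))
      shaved≤t : shave x s corners ≼ t
      shaved≤t i = begin
        rows (shave x s corners) i
          ≡⟨ rows-shave x s corners i ⟩
        rows x i ∸ bit (s i)
          ≤⟨ ∸-bit-anti (rows x i) (λ o → incl i (cong (_∨ coverRows cs i) o)) ⟩
        rows x i ∸ bit (only row i)
          ≡⟨ sym (trans (rows-≡ i) (rows-shave x (only row) (only-corners x corner) i)) ⟩
        rows t i ∎
        where open ≤-Reasoning

    below-covers-bound : ∀ {T} (A : All (Covers x) T) y → All (y ≼_) T →
      ∀ i → coverRows A i ≡ true → rows y i ≤ rows x i ∸ 1
    below-covers-bound {t ∷ _} (c ∷ cs) y (y≤t ∷ y≤ts) i e
      with true-or-false (only (CoverAt.row (covers⇒corner x t c)) i)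
    ... | inj₁ o = ≤-trans (y≤t i) (≤-reflexive (trans (rows-≡ i)
                     (trans (rows-shave x (only row) (only-corners x corner) i) (remove-removed (rows x) (only row) o))))
      where open CoverAt (covers⇒corner x t c)
    ... | inj₂ o = below-covers-bound cs y y≤ts i (subst (λ b → b ∨ coverRows cs i ≡ true) o e)

  move⇒removal : ∀ x y → Move x y →
    Σ (CellRemoval (rows x) (part μ)) λ R → ∀ i → rows y i ≡ remove (rows x) (CellRemoval.removed R) i
  move⇒removal x y ([]    , T≢[] , _ , _) = ⊥-elim (T≢[] refl)
  move⇒removal x y (t ∷ _ , _ , covers@(c ∷ cs) , (y≤x ∷ y≤T) , greatest) =
    R , λ i → ≤-antisym (y≤ i) (subst (_≤ rows y i) (rows-shave x s corners i) (w≤y i))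
    where
    s = coverRows x covers
    corners = coverRows-corner x covers
    k = CoverAt.row (covers⇒corner x t c)
    R : CellRemoval (rows x) (part μ)
    R = record { removed = s ; removed-removable = corners ; witness = k
               ; witness-removed = cong (_∨ coverRows x cs k) (only-same k) }
    w = shave x s corners
    w≤y : ∀ i → rows w i ≤ rows y i
    w≤y = greatest w (proj₁ (shave-< x s corners (CellRemoval.witness-removed R))
                      ∷ shaved-below-covers x covers s corners (λ _ e → e))
    y≤ : ∀ i → rows y i ≤ remove (rows x) s i
    y≤ i = by-cases (true-or-false (s i))
      where
      by-cases : s i ≡ true ⊎ s i ≡ false → rows y i ≤ remove (rows x) s i
      by-cases (inj₁ si) = subst (rows y i ≤_) (sym (remove-removed (rows x) s si))
                             (below-covers-bound x covers y y≤T i si)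
      by-cases (inj₂ si) = subst (rows y i ≤_) (sym (remove-kept (rows x) s si)) (y≤x i)

  corner⇒below-length : ∀ x {i} → Corner x i → i < length (proj₁ x)
  corner⇒below-length x c = positive⇒below-length (proj₁ x) (removable⇒positive (rows x) (part μ) c)

  module CoversOf (x : I) (s : ℕ → Bool) (corners : ∀ i → s i ≡ true → Corner x i) where

    coversBelow : ℕ → List I
    coversAt : ∀ n b → s n ≡ b → List I
    coversBelow zero    = []
    coversBelow (suc n) = coversAt n (s n) refl
    coversAt n true  sn = cover x (corners n sn) ∷ coversBelow n
    coversAt n false _  = coversBelow n

    all-covers : ∀ n → All (Covers x) (coversBelow n)
    all-covers-at : ∀ n b (sn : s n ≡ b) → All (Covers x) (coversAt n b sn)
    all-covers zero    = []
    all-covers (suc n) = all-covers-at n (s n) refl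
    all-covers-at n true  sn = corner⇒covers x (corners n sn) ∷ all-covers n
    all-covers-at n false _  = all-covers n

    nonempty : ∀ {k} → s k ≡ true → ∀ n → k < n → coversBelow n ≢ []
    nonempty-at : ∀ {k} → s k ≡ true → ∀ n b (sn : s n ≡ b) → k < suc n → coversAt n b sn ≢ []
    nonempty sk (suc n) k<n = nonempty-at sk n (s n) refl k<n
    nonempty-at sk n true  _  _       ()
    nonempty-at sk n false sn (s≤s k≤n) =
      nonempty sk n (≤∧≢⇒< k≤n λ { refl → true≢false (trans (sym sk) sn) })

    shaved-below : ∀ n → All (shave x s corners ≼_) (coversBelow n)
    shaved-below-at : ∀ n b (sn : s n ≡ b) → All (shave x s corners ≼_) (coversAt n b sn)
    shaved-below zero    = []
    shaved-below (suc n) = shaved-below-at n (s n) refl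
    shaved-below-at n true  sn = shaved≤cover ∷ shaved-below n
      where
      shaved≤cover : shave x s corners ≼ cover x (corners n sn)
      shaved≤cover i = subst₂ _≤_ (sym (rows-shave x s corners i))
                                  (sym (rows-shave x (only n) (only-corners x (corners n sn)) i))
                                  (∸-bit-anti (rows x i) λ o → trans (cong s (only-true o)) sn)
    shaved-below-at n false _  = shaved-below n

    bound : ∀ z n → All (z ≼_) (coversBelow n) → ∀ {i} → i < n → s i ≡ true → rows z i ≤ rows x i ∸ 1
    bound-at : ∀ z n b (sn : s n ≡ b) → All (z ≼_) (coversAt n b sn) →
      ∀ {i} → i < suc n → s i ≡ true → rows z i ≤ rows x i ∸ 1
    bound z (suc n) z≤T = bound-at z n (s n) refl z≤T
    bound-at z n true sn (z≤c ∷ z≤T) {i} (s≤s i≤n) si with i ≟ n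
    ... | yes refl = ≤-trans (z≤c i) (≤-reflexive (rows-cover-same x (corners n sn)))
    ... | no i≢n   = bound z n z≤T (≤∧≢⇒< i≤n i≢n) si
    bound-at z n false sn z≤T {i} (s≤s i≤n) si =
      bound z n z≤T (≤∧≢⇒< i≤n λ { refl → true≢false (trans (sym si) sn) }) si

  removal⇒move : ∀ x (R : CellRemoval (rows x) (part μ)) →
    Σ I λ y → Move x y × (∀ i → rows y i ≡ remove (rows x) (CellRemoval.removed R) i)
  removal⇒move x R = y , (coversBelow L , nonempty witness-removed L (below witness-removed) , all-covers L
                         , (proj₁ (shave-< x s corners witness-removed) ∷ shaved-below L) , greatest)
                       , rows-shave x s corners
    where
    open CellRemoval R renaming (removed to s; removed-removable to corners)
    open CoversOf x s corners
    L = length (proj₁ x)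
    y = shave x s corners
    below : ∀ {i} → s i ≡ true → i < L
    below si = corner⇒below-length x (corners _ si)
    greatest : ∀ z → All (z ≼_) (x ∷ coversBelow L) → z ≼ y
    greatest z (z≤x ∷ z≤T) i with true-or-false (s i)
    ... | inj₁ si = subst (rows z i ≤_) (sym (trans (rows-shave x s corners i) (remove-removed (rows x) s si)))
                      (bound z L z≤T (below si) si)
    ... | inj₂ si = subst (rows z i ≤_) (sym (trans (rows-shave x s corners i) (remove-kept (rows x) s si))) (z≤x i)

  size : I → ℕ
  size x = sum (proj₁ x)

  removal-shrinks : ∀ x y (R : CellRemoval (rows x) (part μ)) →
    (∀ i → rows y i ≡ remove (rows x) (CellRemoval.removed R) i) → size y < size x
  removal-shrinks x y R rows≡ = sum-strict (proj₁ x) (proj₁ y) y≤x witness yₖ<xₖ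
    where
    open CellRemoval R
    y≤x : ∀ i → rows y i ≤ rows x i
    y≤x i = ≤-trans (≤-reflexive (rows≡ i)) (m∸n≤m (rows x i) (bit (removed i)))
    yₖ<xₖ : rows y witness < rows x witness
    yₖ<xₖ = subst (_< rows x witness) (sym (trans (rows≡ witness) (remove-removed (rows x) removed witness-removed)))
              (n∸1<n (removable⇒positive (rows x) (part μ) (removed-removable witness witness-removed)))

  Outcome : I → Set
  Outcome x = (NoOddPair (rows x) (part μ) → Lose x) × (¬ NoOddPair (rows x) (part μ) → Win x)

  outcome : ∀ x → Outcome x
  outcome = All.wfRec (On.wellFounded size <-wellFounded) _ Outcome step
    where
    step : ∀ x → (∀ {y} → size y < size x → Outcome y) → Outcome x
    step x rec = lose-if , win-if
      where
      L = length (proj₁ x)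
      lose-if : NoOddPair (rows x) (part μ) → Lose x
      lose-if noOdd = lose λ y mv →
        let R , rows≡ = move⇒removal x y mv
        in proj₂ (rec (removal-shrinks x y R rows≡)) λ noOdd′ →
             noOddPair⇒removal-breaks (rows x) (part μ) (rows-anti x) L (λ _ → rows-beyond x) noOdd R
               (NoOddPair-cong (rows y) _ (part μ) rows≡ noOdd′)
      win-if : ¬ NoOddPair (rows x) (part μ) → Win x
      win-if oddPair =
        let R , noOdd′ = oddPair⇒removal-repairs (rows x) (part μ) (rows-anti x) L (λ _ → rows-beyond x) oddPair
            y , mv , rows≡ = removal⇒move x R
        in win y mv (proj₁ (rec (removal-shrinks x y R rows≡))
                           (NoOddPair-cong _ (rows y) (part μ) (sym ∘ rows≡) noOdd′))

-- Blocks of the boundary path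

odd?⇒Odd : ∀ n → odd? n ≡ true → Odd n
odd?⇒Odd (suc zero)    _ = 0 , refl
odd?⇒Odd (suc (suc n)) e =
  let k , n≡ = odd?⇒Odd n (trans (sym (not-involutive (odd? n))) e)
  in suc k , cong (suc ∘ suc) (trans n≡ (sym (+-suc k (k + 0))))

Odd⇒odd? : ∀ n → Odd n → odd? n ≡ true
Odd⇒odd? _ (k , refl) = go k
  where
  go : ∀ k → odd? (suc (2 * k)) ≡ true
  go zero    = refl
  go (suc k) = trans (not-involutive _) (trans (cong odd? (+-suc k (k + 0))) (go k))

zeros : ℕ → ℕ
zeros _ = 0

boundary : (ℕ → ℕ) → ℕ → List Step
boundary f zero    = []
boundary f (suc m) = replicate (eastRun f zeros m) E ++ N ∷ boundary f m

NoEndE : List Step → Set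
NoEndE u = ¬ ∃ λ u′ → u ≡ u′ ++ [ E ]

NoStartN : List Step → Set
NoStartN v = ¬ ∃ λ v′ → v ≡ N ∷ v′

NoEndE-cons : ∀ a {u} → u ≢ [] → NoEndE u → NoEndE (a ∷ u)
NoEndE-cons a u≢[] _   ([]     , eq) = u≢[] (∷-injectiveʳ eq)
NoEndE-cons a _    noE (_ ∷ u′ , eq) = noE (u′ , ∷-injectiveʳ eq)

NoEndE-segment : ∀ A {u} → NoEndE u → NoEndE (A ++ N ∷ u)
NoEndE-segment []      {[]}    _   ([]          , ())
NoEndE-segment []      {[]}    _   (_ ∷ []      , ())
NoEndE-segment []      {[]}    _   (_ ∷ _ ∷ _   , ())
NoEndE-segment []      {_ ∷ _} noE = NoEndE-cons N (λ ()) noE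
NoEndE-segment (a ∷ A) {u}     noE = NoEndE-cons a (λ eq → N≢[] (++-conicalʳ A (N ∷ u) eq)) (NoEndE-segment A noE)
  where
  N≢[] : N ∷ u ≢ []
  N≢[] ()

NoStartN-segment : ∀ {d} w → d ≢ 0 → NoStartN (replicate d E ++ N ∷ w)
NoStartN-segment {zero}  w d≢0 = ⊥-elim (d≢0 refl)
NoStartN-segment {suc d} w _   (_ , ())

replicate-N-unique : ∀ a b {v w} → replicate a N ++ v ≡ replicate b N ++ w → NoStartN v → NoStartN w → a ≡ b
replicate-N-unique zero    zero    _  _  _  = refl
replicate-N-unique zero    (suc b) eq nv _  = ⊥-elim (nv (_ , eq))
replicate-N-unique (suc a) zero    eq _  nw = ⊥-elim (nw (_ , sym eq))
replicate-N-unique (suc a) (suc b) eq nv nw = cong suc (replicate-N-unique a b (∷-injectiveʳ eq) nv nw)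

replicate-E-split : ∀ i i′ {X Y} → replicate i E ++ N ∷ X ≡ replicate i′ E ++ N ∷ Y → i ≡ i′ × X ≡ Y
replicate-E-split zero    zero     eq = refl , ∷-injectiveʳ eq
replicate-E-split (suc i) (suc i′) eq =
  let i≡ , X≡ = replicate-E-split i i′ (∷-injectiveʳ eq) in cong suc i≡ , X≡

split-first-segment : ∀ c u R W → u ≢ [] → NoEndE u → u ++ E ∷ R ≡ replicate c E ++ N ∷ W →
  ∃ λ u″ → u ≡ replicate c E ++ N ∷ u″ × u″ ++ E ∷ R ≡ W
split-first-segment c       []           R W u≢[] _   _  = ⊥-elim (u≢[] refl)
split-first-segment zero    (N ∷ u′)     R W _    _   eq = u′ , refl , ∷-injectiveʳ eq
split-first-segment (suc c) (E ∷ [])     R W _    noE _  = ⊥-elim (noE ([] , refl))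
split-first-segment (suc c) (E ∷ y ∷ u′) R W _    noE eq =
  let u″ , u≡ , W≡ = split-first-segment c (y ∷ u′) R W (λ ()) (λ (w , e) → noE (E ∷ w , cong (E ∷_) e))
                                         (∷-injectiveʳ eq)
  in u″ , cong (E ∷_) u≡ , W≡

boundary-prefix : ∀ f m k → k < m → ∃ λ u → boundary f m ≡ u ++ boundary f (suc k) × NoEndE u
boundary-prefix f (suc m) k (s≤s k≤m) with m≤n⇒m<n∨m≡n k≤m
... | inj₂ refl = [] , refl , λ { ([] , ()) ; (_ ∷ _ , ()) }
... | inj₁ k<m  =
  let u , eq , noE = boundary-prefix f m k k<m
  in replicate (eastRun f zeros m) E ++ N ∷ u
   , trans (cong (λ w → replicate (eastRun f zeros m) E ++ N ∷ w) eq)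
           (sym (++-assoc (replicate (eastRun f zeros m) E) (N ∷ u) _))
   , NoEndE-segment (replicate (eastRun f zeros m) E) noE

northRun-positive : ∀ f g k → northRun f g k ≡ suc (pred (northRun f g k))
northRun-positive f g zero = refl
northRun-positive f g (suc k) with joined? f g k
... | yes _ = refl
... | no _  = refl

module Boundary (f : ℕ → ℕ) (f-anti : ∀ i → f (suc i) ≤ f i)
                (m : ℕ) (positive : ∀ {i} → i < m → 0 < f i) where

  north-prefix : ∀ k → k ≤ m →
    ∃ λ v → boundary f k ≡ replicate (pred (northRun f zeros k)) N ++ v × NoStartN v
  north-prefix zero    _   = [] , refl , λ { (_ , ()) }
  north-prefix (suc j) j<m with joined? f zeros j
  ... | yes joined =
    let v , eq , noN = north-prefix j (<⇒≤ j<m)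
    in v , (begin
         replicate (eastRun f zeros j) E ++ N ∷ boundary f j
           ≡⟨ cong (λ d → replicate d E ++ N ∷ boundary f j) (joined⇒eastRun≡0 f zeros joined) ⟩
         N ∷ boundary f j
           ≡⟨ cong (N ∷_) eq ⟩
         replicate (suc (pred (northRun f zeros j))) N ++ v
           ≡⟨ cong (λ b → replicate b N ++ v) (sym (northRun-positive f zeros j)) ⟩
         replicate (northRun f zeros j) N ++ v ∎) , noN
    where open ≡-Reasoning
  ... | no ¬joined = boundary f (suc j) , refl , NoStartN-segment (boundary f j) east≢0
    where
    east≢0 : eastRun f zeros j ≢ 0
    east≢0 east≡0 = ¬joined (eastRun≡0⇒joined f zeros (f-anti j) east≡0 (<-≤-trans (positive j<m) fⱼ≤))
      where fⱼ≤ = ≤-trans (m∸n≡0⇒m≤n east≡0) (≤-reflexive (⊔-identityʳ (f (suc j))))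

  north-run : ∀ {k j v} → k ≤ m → boundary f k ≡ replicate j N ++ v → NoStartN v → northRun f zeros k ≡ suc j
  north-run {k} {j} k≤m eq noN =
    let v′ , eq′ , noN′ = north-prefix k k≤m
    in trans (northRun-positive f zeros k) (cong suc (replicate-N-unique _ j (trans (sym eq′) eq) noN′ noN))

  oddPair⇒block : ∀ {k} → k < m → odd? (eastRun f zeros k) ≡ true → odd? (northRun f zeros k) ≡ true →
    HasOddEOddN (boundary f m)
  oddPair⇒block {k} k<m oddE oddN =
    u , eastRun f zeros k , northRun f zeros k , v , eq , odd?⇒Odd _ oddE , odd?⇒Odd _ oddN , noE , noN
    where
    u = proj₁ (boundary-prefix f m k k<m)
    noE = proj₂ (proj₂ (boundary-prefix f m k k<m))
    v = proj₁ (north-prefix k (<⇒≤ k<m))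
    noN = proj₂ (proj₂ (north-prefix k (<⇒≤ k<m)))
    eq : boundary f m ≡ u ++ replicate (eastRun f zeros k) E ++ replicate (northRun f zeros k) N ++ v
    eq = begin
      boundary f m
        ≡⟨ proj₁ (proj₂ (boundary-prefix f m k k<m)) ⟩
      u ++ replicate (eastRun f zeros k) E ++ N ∷ boundary f k
        ≡⟨ cong (λ w → u ++ replicate (eastRun f zeros k) E ++ N ∷ w)
                (proj₁ (proj₂ (north-prefix k (<⇒≤ k<m)))) ⟩
      u ++ replicate (eastRun f zeros k) E ++ replicate (suc (pred (northRun f zeros k))) N ++ v
        ≡⟨ cong (λ b → u ++ replicate (eastRun f zeros k) E ++ replicate b N ++ v)
                (sym (northRun-positive f zeros k)) ⟩
      u ++ replicate (eastRun f zeros k) E ++ replicate (northRun f zeros k) N ++ v ∎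
      where open ≡-Reasoning

  block⇒oddPair : ∀ m′ → m′ ≤ m → HasOddEOddN (boundary f m′) →
    ∃ λ k → k < m′ × odd? (eastRun f zeros k) ≡ true × odd? (northRun f zeros k) ≡ true
  block⇒oddPair zero _ ([]    , suc i , _ , _ , () , _)
  block⇒oddPair zero _ (_ ∷ _ , suc i , _ , _ , () , _)
  block⇒oddPair _    _ (_ , zero , _ , _ , _ , (_ , ()) , _)
  block⇒oddPair _    _ (_ , suc i , zero , _ , _ , _ , (_ , ()) , _)
  block⇒oddPair (suc m′) m′<m ([] , suc i , suc j , v , eq , oddE , oddN , _ , noN) =
    let east≡ , rest≡ = replicate-E-split (eastRun f zeros m′) (suc i) eq
    in m′ , ≤-refl
     , trans (cong odd? east≡) (Odd⇒odd? _ oddE)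
     , trans (cong odd? (north-run (<⇒≤ m′<m) rest≡ noN)) (Odd⇒odd? _ oddN)
  block⇒oddPair (suc m′) m′<m (x ∷ u , suc i , suc j , v , eq , oddE , oddN , noE , noN) =
    let u″ , u≡ , rest≡ = split-first-segment (eastRun f zeros m′) (x ∷ u) _ (boundary f m′) (λ ()) noE (sym eq)
        noE″ : NoEndE u″
        noE″ = λ (w , e) → noE (replicate (eastRun f zeros m′) E ++ N ∷ w
                               , trans u≡ (trans (cong (λ w′ → replicate (eastRun f zeros m′) E ++ N ∷ w′) e)
                                                 (sym (++-assoc (replicate (eastRun f zeros m′) E) (N ∷ w) [ E ]))))
        k , k<m′ , odd-pair = block⇒oddPair m′ (<⇒≤ m′<m)
                                (u″ , suc i , suc j , v , sym rest≡ , oddE , oddN , noE″ , noN)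
    in k , m<n⇒m<1+n k<m′ , odd-pair

rowsFromBottom : (ℕ → ℕ) → ℕ → List ℕ
rowsFromBottom f zero    = []
rowsFromBottom f (suc m) = f m ∷ rowsFromBottom f m

rowsFromBottom-suc : ∀ f m → rowsFromBottom (f ∘ suc) m ++ [ f 0 ] ≡ rowsFromBottom f (suc m)
rowsFromBottom-suc f zero    = refl
rowsFromBottom-suc f (suc m) = cong (f (suc m) ∷_) (rowsFromBottom-suc f m)

reverse≡rowsFromBottom : ∀ l → reverse l ≡ rowsFromBottom (part l) (length l)
reverse≡rowsFromBottom []      = refl
reverse≡rowsFromBottom (a ∷ l) = begin
  reverse (a ∷ l)                              ≡⟨ unfold-reverse a l ⟩
  reverse l ++ [ a ]                           ≡⟨ cong (_++ [ a ]) (reverse≡rowsFromBottom l) ⟩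
  rowsFromBottom (part l) (length l) ++ [ a ]  ≡⟨ rowsFromBottom-suc (part (a ∷ l)) (length l) ⟩
  rowsFromBottom (part (a ∷ l)) (suc (length l)) ∎
  where open ≡-Reasoning

pathAux≡boundary : ∀ f m → pathAux (f m) (rowsFromBottom f m) ≡ boundary f m
pathAux≡boundary f zero    = refl
pathAux≡boundary f (suc m) = cong₂ (λ d w → replicate d E ++ N ∷ w)
  (cong (f m ∸_) (sym (⊔-identityʳ (f (suc m))))) (pathAux≡boundary f m)

path≡boundary : ∀ l → path l ≡ boundary (part l) (length l)
path≡boundary l = begin
  pathAux 0 (reverse l)
    ≡⟨ cong₂ pathAux (sym (part-beyond l ≤-refl)) (reverse≡rowsFromBottom l) ⟩
  pathAux (part l (length l)) (rowsFromBottom (part l) (length l))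
    ≡⟨ pathAux≡boundary (part l) (length l) ⟩
  boundary (part l) (length l) ∎
  where open ≡-Reasoning

-- Intervals between two staircases

oddPair-zeros : ∀ f g → (∀ k → g k ≤ f (suc k)) → (∀ k → 0 < f k → g k < f k) →
  ∀ k → oddPair f g k ≡ oddPair f zeros k
oddPair-zeros f g g≤f₁ g<f k = cong₂ (λ a b → odd? a ∧ odd? b)
  (cong (f k ∸_) (trans (m≥n⇒m⊔n≡m (g≤f₁ k)) (sym (⊔-identityʳ (f (suc k))))))
  (same-northRun k)
  where
  same-northRun : ∀ k → northRun f g k ≡ northRun f zeros k
  same-northRun zero    = refl
  same-northRun (suc k) with joined? f g k | joined? f zeros k
  ... | yes _           | yes _      = cong suc (same-northRun k)
  ... | no _            | no _       = refl
  ... | yes (fₖ≡ , g<)  | no ¬joined = ⊥-elim (¬joined (fₖ≡ , ≤-<-trans z≤n g<))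
  ... | no ¬joined      | yes (fₖ≡ , 0<) =
    ⊥-elim (¬joined (fₖ≡ , subst (g k <_) fₖ≡ (g<f k (subst (0 <_) (sym fₖ≡) 0<))))

part-δ : ∀ n i → part (δ n) i ≡ n ∸ i
part-δ zero    i       = sym (0∸n≡0 i)
part-δ (suc n) zero    = refl
part-δ (suc n) (suc i) = part-δ n i

module Staircase (μ λ′ : List ℕ) (pλ : IsPartition λ′) {n : ℕ}
                 (μ⊑δ : μ ⊑ δ n) (δ⊑λ : δ (suc n) ⊑ λ′) where

  staircase-below-next : ∀ k → part μ k ≤ part λ′ (suc k)
  staircase-below-next k = ≤-trans (μ⊑δ k) (δ⊑λ (suc k))

  staircase-below : ∀ k → 0 < part λ′ k → part μ k < part λ′ k
  staircase-below k 0<λₖ with k ≤? n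
  ... | yes k≤n = begin-strict
    part μ k         ≤⟨ μ⊑δ k ⟩
    part (δ n) k     ≡⟨ part-δ n k ⟩
    n ∸ k            <⟨ ∸-monoˡ-< (n<1+n n) k≤n ⟩
    suc n ∸ k        ≡⟨ sym (part-δ (suc n) k) ⟩
    part (δ (suc n)) k ≤⟨ δ⊑λ k ⟩
    part λ′ k        ∎
    where open ≤-Reasoning
  ... | no k≰n = ≤-<-trans (≤-trans (μ⊑δ k) (≤-reflexive (trans (part-δ n k) n∸k≡0))) 0<λₖ
    where n∸k≡0 = m≤n⇒m∸n≡0 (<⇒≤ (≰⇒> k≰n))

  oddPair≡ : ∀ k → oddPair (part λ′) (part μ) k ≡ oddPair (part λ′) zeros k
  oddPair≡ = oddPair-zeros (part λ′) (part μ) staircase-below-next staircase-below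

  open Boundary (part λ′) (part-anti pλ) (length λ′) (part-positive pλ)

  path-block⇒oddPair : HasOddEOddN (path λ′) → ¬ NoOddPair (part λ′) (part μ)
  path-block⇒oddPair block noOdd =
    let k , _ , oddE , oddN = block⇒oddPair (length λ′) ≤-refl (subst HasOddEOddN (path≡boundary λ′) block)
    in true≢false (trans (sym (trans (oddPair≡ k) (cong₂ _∧_ oddE oddN))) (noOdd k))

  no-path-block⇒noOddPair : ¬ HasOddEOddN (path λ′) → NoOddPair (part λ′) (part μ)
  no-path-block⇒noOddPair ¬block k with true-or-false (oddPair (part λ′) (part μ) k)
  ... | inj₂ even = even
  ... | inj₁ odd  = ⊥-elim (¬block (subst HasOddEOddN (sym (path≡boundary λ′))
                      (oddPair⇒block k<L (∧-true-left odd′) (∧-true-right odd′))))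
    where
    odd′ = trans (sym (oddPair≡ k)) odd
    k<L = positive⇒below-length λ′
            (removable⇒positive (part λ′) (part μ) (oddPair⇒removable (part λ′) (part μ) odd))

module _ {P : Set} {_≤P_ : P → P → Set} where
  open Ungar P _≤P_

  ¬win×lose : ∀ {x} → Win x → Lose x → ⊥
  ¬win×lose (win y move lose-y) (lose win-all) = ¬win×lose (win-all y move) lose-y

theorem1p5 : (μ λ′ : List ℕ) (pμ : IsPartition μ) (pλ : IsPartition λ′) (μ⊑λ : μ ⊑ λ′)
    (n : ℕ) → μ ⊑ δ n → (∀ m → m < n → ¬ (μ ⊑ δ m)) →
    δ (suc n) ⊑ λ′ →
    (IntervalEetaWin μ λ′ pλ μ⊑λ → ¬ HasOddEOddN (path λ′)) × (¬ HasOddEOddN (path λ′) → IntervalEetaWin μ λ′ pλ μ⊑λ)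
theorem1p5 μ λ′ _ pλ μ⊑λ _ μ⊑δ _ δ⊑λ = eeta⇒no-block , no-block⇒eeta
  where
  open Young μ λ′
  open Staircase μ λ′ pλ μ⊑δ δ⊑λ
  top = topI μ λ′ pλ μ⊑λ

  eeta⇒no-block : IntervalEetaWin μ λ′ pλ μ⊑λ → ¬ HasOddEOddN (path λ′)
  eeta⇒no-block eeta block = eeta (proj₂ (outcome top) (path-block⇒oddPair block))

  no-block⇒eeta : ¬ HasOddEOddN (path λ′) → IntervalEetaWin μ λ′ pλ μ⊑λ
  no-block⇒eeta ¬block atniss = ¬win×lose atniss (proj₁ (outcome top) (no-path-block⇒noOddPair ¬block))
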